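{- Let $f:\{0,1\}^n\to\{0,1\}$ be a Boolean function whose upward closure $f^{\uparrow}$ is non-constant. Then \[ \mathrm{Arith}\big(\mathrm{Env}(\mathrm{Low}(f))\big)\leq \mathrm{Read}_1(f^{\uparrow})\leq \mathrm{mLin}(f^{\uparrow})\leq \mathrm{Lin}(f). \]
   Context: The upward closure of a Boolean function $f$ is the monotone function $f^{\uparrow}(x)=\bigvee_{z\leq x}f(z)$. For any Boolean $f$, $\mathrm{Low}(f)$ is the set of $a\in\{0,1\}^n$ with $f(a)=1$ and $f(b)=0$ for all $b\leq a$, $b\neq a$. A monotone Boolean circuit is a directed acyclic graph (parallel edges allowed) whose indegree-zero nodes hold variables among $x_1,\dots,x_n$ (no constants) and whose gates have indegree two and are labeled $\lor$ or $\land$; size = number of gates. The set $B_F\subseteq\mathbb{N}^n$ of exponent vectors produced by $F$: $B_{x_i}=\{e_i\}$, $B_{G\lor H}=B_G\cup B_H$, $B_{G\land H}=\{b+c:b\in B_G,c\in B_H\}$. $\mathrm{supp}(a)=\{i:a_i\neq 0\}$. A monotone circuit computing a monotone $g$ is read-$1$ if $\mathrm{Low}(g)\subseteq B_F$ (equivalently every $a\in\mathrm{Low}(g)$ has $b\in B_F$ with $\mathrm{supp}(b)=\mathrm{supp}(a)$ and all $b_i\leq1$); $\mathrm{Read}_1(g)$ is the minimum size of such a circuit. A DeMorgan circuit is a $(\lor,\land)$ circuit whose inputs are the literals $x_1,\dots,x_n,\bar x_1,\dots,\bar x_n$. A Boolean function depends on $x_i$ if its value changes for some pair of inputs differing only in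 position $i$; two functions are independent if they depend on disjoint sets of variables. A (DeMorgan or monotone) circuit is multilinear if the two functions computed at the inputs of every AND gate are independent. $\mathrm{Lin}(f)$ is the minimum size of a multilinear DeMorgan circuit computing $f$; for monotone $g$, $\mathrm{mLin}(g)$ is the minimum size of a monotone multilinear circuit computing $g$. For finite $A\subseteq\mathbb{N}^n$, $\mathrm{Arith}(A)$ is the minimum size of a monotone arithmetic $(+,\times)$ circuit with only variables as inputs producing (as formal expansion, no cancellations) a polynomial $\sum_{a\in A}c_a\prod_ix_i^{a_i}$ with integers $c_a\geq1$. $\mathrm{Env}(A)$ is the set of vectors $a\in A$ of minimum degree $a_1+\dots+a_n$. -}

module Defs where

open import Data.Nat using (ℕ; zero; suc; _+_; _≤_)
open import Data.Bool as B using (Bool; true; false; not; _∧_; _∨_; if_then_else_)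
open import Data.Bool.Properties using () renaming (_≤?_ to _≤ᵇ?_)
open import Data.Fin using (Fin; zero; suc)
open import Data.Vec as V using (Vec; []; _∷_; lookup; updateAt; replicate; zipWith; _[_]≔_)
open import Data.Vec.Relation.Binary.Pointwise.Inductive as PW using (Pointwise)
open import Data.List as L using (List; _++_; [_]; cartesianProductWith)
open import Data.Bool.ListAction using (any)
open import Data.List.Membership.Propositional using (_∈_)
open import Data.Sum using (_⊎_; inj₁; inj₂)
open import Data.Product using (Σ; ∃; _×_; _,_)
open import Data.Unit using (⊤)
open import Relation.Nullary using (¬_; does)
open import Relation.Binary.PropositionalEquality using (_≡_; _≢_)
open import Function.Bundles using (_⇔_)

Input : ℕ → Set
Input n = Vec Bool n

BoolFun : ℕ → Set
BoolFun n = Input n → Bool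

_≼_ : ∀ {n} → Input n → Input n → Set
_≼_ = Pointwise B._≤_

_≼?_ : ∀ {n} (x y : Input n) → Relation.Nullary.Dec (x ≼ y)
_≼?_ = PW.decidable _≤ᵇ?_

allInputs : (n : ℕ) → List (Input n)
allInputs zero    = [ [] ]
allInputs (suc n) = L.map (false ∷_) (allInputs n) ++ L.map (true ∷_) (allInputs n)

up : ∀ {n} → BoolFun n → BoolFun n
up {n} f x = any (λ z → f z ∧ does (z ≼? x)) (allInputs n)

NonConstant : ∀ {n} → BoolFun n → Set
NonConstant f = ∃ λ x → ∃ λ y → f x ≢ f y

Low : ∀ {n} → BoolFun n → Input n → Set
Low f a = f a ≡ true × (∀ b → b ≼ a → b ≢ a → f b ≡ false)

DependsOn : ∀ {n} → BoolFun n → Fin n → Set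
DependsOn f i = ∃ λ x → f x ≢ f (updateAt x i not)

Independent : ∀ {n} → BoolFun n → BoolFun n → Set
Independent f g = ∀ i → ¬ (DependsOn f i × DependsOn g i)

Exp : ℕ → Set
Exp n = Vec ℕ n

bit : Bool → ℕ
bit b = if b then 1 else 0

embed : ∀ {n} → Input n → Exp n
embed = V.map bit

unitVec : ∀ {n} → Fin n → Exp n
unitVec {n} i = replicate n 0 [ i ]≔ 1

_+ᵥ_ : ∀ {n} → Exp n → Exp n → Exp n
_+ᵥ_ = zipWith _+_

degree : ∀ {n} → Exp n → ℕ
degree = V.sum

LowExp : ∀ {n} → BoolFun n → Exp n → Set
LowExp f a = Σ (Input _) λ b → Low f b × a ≡ embed b

Env : ∀ {n} → (Exp n → Set) → Exp n → Set
Env A a = A a × (∀ b → A b → degree a ≤ degree b)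

-- Circuits as straight-line programs (DAGs, parallel edges allowed).  Gate `zero` is the most recently added one.

data Node (I : Set) (k : ℕ) : Set where
  input : I → Node I k
  gate  : Fin k → Node I k

data Gates (Op I : Set) : ℕ → Set where
  []  : Gates Op I zero
  _▷_ : ∀ {k} → Gates Op I k → Op × Node I k × Node I k → Gates Op I (suc k)

record Circuit (Op I : Set) : Set where
  constructor circuit
  field
    size   : ℕ
    gates  : Gates Op I size
    output : Node I size
open Circuit public

module Eval {a} {A : Set a} {Op I : Set}
            (⟦_⟧ᵒ : Op → A → A → A) (⟦_⟧ⁱ : I → A) where

  gateVals : ∀ {k} → Gates Op I k → Fin k → A
  nodeVal  : ∀ {k} → Gates Op I k → Node I k → A

  nodeVal gs (input i) = ⟦ i ⟧ⁱ
  nodeVal gs (gate j)  = gateVals gs j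

  gateVals (gs ▷ (o , l , r)) zero    = ⟦ o ⟧ᵒ (nodeVal gs l) (nodeVal gs r)
  gateVals (gs ▷ g)           (suc j) = gateVals gs j

  value : Circuit Op I → A
  value C = nodeVal (gates C) (output C)

AllGates : ∀ {Op I} → (∀ {k} → Gates Op I k → Op × Node I k × Node I k → Set)
         → ∀ {k} → Gates Op I k → Set
AllGates P []       = ⊤
AllGates P (gs ▷ g) = AllGates P gs × P gs g

data BOp : Set where
  or and : BOp

⟦_⟧ᵇ : BOp → Bool → Bool → Bool
⟦ or  ⟧ᵇ = _∨_
⟦ and ⟧ᵇ = _∧_

-- literals: inj₁ i = x_i, inj₂ i = ¬x_i
Lit : ℕ → Set
Lit n = Fin n ⊎ Fin n

MonCircuit : ℕ → Set
MonCircuit n = Circuit BOp (Fin n)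

DMCircuit : ℕ → Set
DMCircuit n = Circuit BOp (Lit n)

varVal : ∀ {n} → Input n → Fin n → Bool
varVal x i = lookup x i

litVal : ∀ {n} → Input n → Lit n → Bool
litVal x (inj₁ i) = lookup x i
litVal x (inj₂ i) = not (lookup x i)

nodeFun : ∀ {n} {I : Set} → (Input n → I → Bool)
        → ∀ {k} → Gates BOp I k → Node I k → BoolFun n
nodeFun ι gs v x = Eval.nodeVal ⟦_⟧ᵇ (ι x) gs v

Computes : ∀ {n} {I : Set} → (Input n → I → Bool) → Circuit BOp I → BoolFun n → Set
Computes ι C f = ∀ x → nodeFun ι (gates C) (output C) x ≡ f x

MultilinearGate : ∀ {n} {I : Set} → (Input n → I → Bool)
                → ∀ {k} → Gates BOp I k → BOp × Node I k × Node I k → Set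
MultilinearGate ι gs (or  , l , r) = ⊤
MultilinearGate ι gs (and , l , r) = Independent (nodeFun ι gs l) (nodeFun ι gs r)

Multilinear : ∀ {n} {I : Set} → (Input n → I → Bool) → Circuit BOp I → Set
Multilinear ι C = AllGates (MultilinearGate ι) (gates C)

⟦_⟧ᴮ : ∀ {n} → BOp → List (Exp n) → List (Exp n) → List (Exp n)
⟦ or  ⟧ᴮ = _++_
⟦ and ⟧ᴮ = cartesianProductWith _+ᵥ_

Bset : ∀ {n} → MonCircuit n → List (Exp n)
Bset C = Eval.value ⟦_⟧ᴮ (λ i → [ unitVec i ]) C

-- Monotone arithmetic circuits; the formal expansion is the list of
-- monomials (exponent vectors) with multiplicity = coefficient.

data AOp : Set where
  plus times : AOp

⟦_⟧ᴬ : ∀ {n} → AOp → List (Exp n) → List (Exp n) → List (Exp n)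
⟦ plus  ⟧ᴬ = _++_
⟦ times ⟧ᴬ = cartesianProductWith _+ᵥ_

ArithCircuit : ℕ → Set
ArithCircuit n = Circuit AOp (Fin n)

expansion : ∀ {n} → ArithCircuit n → List (Exp n)
expansion C = Eval.value ⟦_⟧ᴬ (λ i → [ unitVec i ]) C

-- C produces Σ_{a∈A} c_a x^a with all c_a ≥ 1 (and no other monomials)
Produces : ∀ {n} → ArithCircuit n → (Exp n → Set) → Set
Produces C A = ∀ a → (a ∈ expansion C) ⇔ A a

IsMinSize : ∀ {Op I} → (Circuit Op I → Set) → ℕ → Set
IsMinSize P m = (Σ (Circuit _ _) λ C → P C × size C ≡ m)
              × (∀ C → P C → m ≤ size C)

IsArith : ∀ {n} → (Exp n → Set) → ℕ → Set
IsArith A = IsMinSize (λ C → Produces C A)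

IsRead1 : ∀ {n} → BoolFun n → ℕ → Set
IsRead1 g = IsMinSize (λ (C : MonCircuit _) →
  Computes varVal C g × (∀ a → Low g a → embed a ∈ Bset C))

IsMLin : ∀ {n} → BoolFun n → ℕ → Set
IsMLin g = IsMinSize (λ (C : MonCircuit _) → Computes varVal C g × Multilinear varVal C)

IsLin : ∀ {n} → BoolFun n → ℕ → Set
IsLin f = IsMinSize (λ (C : DMCircuit _) → Computes litVal C f × Multilinear litVal C)

-- Lin ≥ mLin: the upward closure commutes with ∨, with ∧ of independent functions, keeps xᵢ and
-- sends ¬xᵢ to the constant 1. A node h of a multilinear DeMorgan circuit with h(0) = 1 has
-- constant closure; absorbing those nodes into their parents and replacing every other node h by
-- h↑ gives a monotone multilinear circuit of the same size for f↑ (f↑ non-constant forces f(0) = 0).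
-- mLin ≥ Read₁: below an AND gate of independent g, h, a minimal point of g ∧ h splits along the
-- variables of g into minimal points of g and of h, so Low of every node lies in its B-set.
-- Read₁ ≥ Arith: keeping at every OR gate only the inputs of least minimum degree yields an
-- arithmetic circuit producing the minimum-degree part of B_F. Every b ∈ B_F lies above a point of
-- Low(f↑) = Low(f), which is itself in B_F, so that part is exactly Env(Low f).
module Submission where

open import Defs
open import Data.Bool as Bool using (Bool; true; false; not; _∧_; _∨_; if_then_else_; T)
open import Data.Bool.Properties as BoolP using (T-≡; T-∧)
open import Data.Fin as Fin using (Fin; zero; suc)
open import Data.List using (List; [_])
open import Data.List.Membership.Propositional using (_∈_; lose)
open import Data.List.Membership.Propositional.Properties
  using (∈-++⁺ˡ; ∈-++⁺ʳ; ∈-++⁻; ∈-map⁺; ∈-cartesianProductWith⁺; ∈-cartesianProductWith⁻)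
open import Data.List.Relation.Unary.Any as Any using (here; any?)
open import Data.List.Relation.Unary.Any.Properties using (any⁻; any⁺)
open import Data.Nat as ℕ using (ℕ; zero; suc; _≤_; _<_; _+_; _⊓_; z≤n; s≤s)
open import Data.Nat.Induction using (<-wellFounded)
open import Data.Nat.Properties as ℕP using ()
open import Algebra.Properties.CommutativeSemigroup ℕP.+-commutativeSemigroup using (interchange)
open import Data.Product using (∃; _×_; _,_; proj₁; proj₂)
open import Data.Sum as Sum using (_⊎_; inj₁; inj₂)
open import Data.Unit using (tt)
open import Data.Vec as Vec using (Vec; []; _∷_; lookup; tabulate; replicate; updateAt; _[_]≔_)
open import Data.Vec.Properties as VecP using ()
open import Data.Vec.Relation.Binary.Pointwise.Inductive as PW using (Pointwise; []; _∷_)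
open import Data.Vec.Relation.Binary.Pointwise.Extensional using (ext; extensional⇒inductive)
open import Function using (_∘_)
open import Function.Bundles using (_⇔_; mk⇔; Equivalence)
open import Induction.WellFounded using (Acc; acc)
open import Relation.Nullary using (¬?; Dec; yes; no; does; contradiction; _×-dec_)
open import Relation.Nullary.Decidable using (map′; dec-true; dec-false; decidable-stable)
open import Relation.Binary.PropositionalEquality hiding ([_])

open Equivalence using (to; from)

private
  variable
    n k : ℕ

∧≡true⁺ : ∀ {a b} → a ≡ true → b ≡ true → a ∧ b ≡ true
∧≡true⁺ refl refl = refl

∧≡true⁻ : ∀ {a b} → a ∧ b ≡ true → a ≡ true × b ≡ true
∧≡true⁻ {true} {true} _ = refl , refl

∨≡true⁺ : ∀ {a b} → a ≡ true ⊎ b ≡ true → a ∨ b ≡ true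
∨≡true⁺         (inj₁ refl) = refl
∨≡true⁺ {a = a} (inj₂ refl) = BoolP.∨-zeroʳ a

∨≡true⁻ : ∀ {a b} → a ∨ b ≡ true → a ≡ true ⊎ b ≡ true
∨≡true⁻ {true}  _ = inj₁ refl
∨≡true⁻ {false} e = inj₂ e

≤-true : ∀ {a b} → a Bool.≤ b → a ≡ true → b ≡ true
≤-true Bool.b≤b a≡true = a≡true

≤-false : ∀ {a b} → a Bool.≤ b → b ≡ false → a ≡ false
≤-false Bool.b≤b b≡false = b≡false

≡true-ext : ∀ {a b} → (a ≡ true → b ≡ true) → (b ≡ true → a ≡ true) → a ≡ b
≡true-ext {false} {false} _   _   = refl
≡true-ext {false} {true}  _   b⇒a = b⇒a refl
≡true-ext {true}  {false} a⇒b _   = sym (a⇒b refl)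
≡true-ext {true}  {true}  _   _   = refl

T-does⁻ : ∀ {A : Set} (a? : Dec A) → T (does a?) → A
T-does⁻ (yes a) _ = a

pointwise⁺ : ∀ {A B : Set} {R : A → B → Set} {xs : Vec A n} {ys : Vec B n} →
             (∀ i → R (lookup xs i) (lookup ys i)) → Pointwise R xs ys
pointwise⁺ = extensional⇒inductive ∘ ext

≡-lookup : ∀ {A : Set} {xs ys : Vec A n} → (∀ i → lookup xs i ≡ lookup ys i) → xs ≡ ys
≡-lookup = PW.Pointwise-≡⇒≡ ∘ pointwise⁺

∈-allInputs : (x : Input n) → x ∈ allInputs n
∈-allInputs []          = here refl
∈-allInputs (false ∷ x) = ∈-++⁺ˡ (∈-map⁺ (false ∷_) (∈-allInputs x))
∈-allInputs (true ∷ x)  = ∈-++⁺ʳ _ (∈-map⁺ (true ∷_) (∈-allInputs x))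

∃-input? : {P : Input n → Set} → (∀ x → Dec (P x)) → Dec (∃ P)
∃-input? P? = map′ Any.satisfied (λ (x , px) → lose (∈-allInputs x) px) (any? P? (allInputs _))

_≟ᵢ_ : (x y : Input n) → Dec (x ≡ y)
_≟ᵢ_ = VecP.≡-dec BoolP._≟_

≼-refl : {x : Input n} → x ≼ x
≼-refl = PW.refl BoolP.≤-refl

≼-trans : {x y z : Input n} → x ≼ y → y ≼ z → x ≼ z
≼-trans = PW.trans BoolP.≤-trans

allFalse : Input n
allFalse = replicate _ false

allFalse-≼ : {x : Input n} → allFalse ≼ x
allFalse-≼ {x = []}    = []
allFalse-≼ {x = _ ∷ _} = BoolP.≤-minimum _ ∷ allFalse-≼

weight : Input n → ℕ
weight a = degree (embed a)

bit-mono : ∀ {x y} → x Bool.≤ y → bit x ≤ bit y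
bit-mono Bool.b≤b = ℕP.≤-refl
bit-mono Bool.f≤t = z≤n

weight-mono : {a b : Input n} → a ≼ b → weight a ≤ weight b
weight-mono []       = z≤n
weight-mono (p ∷ ps) = ℕP.+-mono-≤ (bit-mono p) (weight-mono ps)

weight-strict : {a b : Input n} → a ≼ b → a ≢ b → weight a < weight b
weight-strict {a = []}    []              a≢b = contradiction refl a≢b
weight-strict {a = x ∷ _} (Bool.b≤b ∷ ps) a≢b = ℕP.+-monoʳ-< (bit x) (weight-strict ps (a≢b ∘ cong (x ∷_)))
weight-strict             (Bool.f≤t ∷ ps) _   = s≤s (weight-mono ps)

≼-weight-≡ : {a s : Input n} → a ≼ s → weight a ≡ weight s → a ≡ s
≼-weight-≡ {a = a} {s} a≼s e with a ≟ᵢ s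
... | yes a≡s = a≡s
... | no a≢s  = contradiction e (ℕP.<⇒≢ (weight-strict a≼s a≢s))

≼-trans-≢ : {z b a : Input n} → z ≼ b → b ≼ a → b ≢ a → z ≢ a
≼-trans-≢ z≼b b≼a b≢a refl = ℕP.<-irrefl refl (ℕP.≤-<-trans (weight-mono z≼b) (weight-strict b≼a b≢a))

up≡true⁻ : ∀ (f : BoolFun n) {x} → up f x ≡ true → ∃ λ z → z ≼ x × f z ≡ true
up≡true⁻ f {x} e
  with z , Tz ← Any.satisfied (any⁻ (λ z → f z ∧ does (z ≼? x)) (allInputs _) (T-≡ .from e))
  with fz , z≼x ← T-∧ .to Tz = z , T-does⁻ (z ≼? x) z≼x , T-≡ .to fz

up≡true⁺ : ∀ (f : BoolFun n) {x z} → z ≼ x → f z ≡ true → up f x ≡ true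
up≡true⁺ f {z = z} z≼x fz =
  T-≡ .to (any⁺ _ (lose (∈-allInputs z) (T-∧ .from (T-≡ .from fz , T-≡ .from (dec-true (z ≼? _) z≼x)))))

up-mono : ∀ {f g : BoolFun n} → (∀ x → f x ≡ true → g x ≡ true) → ∀ {x} → up f x ≡ true → up g x ≡ true
up-mono {f = f} {g} f⇒g u with z , z≼x , fz ← up≡true⁻ f u = up≡true⁺ g z≼x (f⇒g z fz)

up-cong : ∀ {f g : BoolFun n} → (∀ x → f x ≡ g x) → ∀ x → up f x ≡ up g x
up-cong f≗g x = ≡true-ext (up-mono λ z fz → trans (sym (f≗g z)) fz) (up-mono λ z gz → trans (f≗g z) gz)

up-allFalse : ∀ (f : BoolFun n) {x} → f allFalse ≡ true → up f x ≡ true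
up-allFalse f = up≡true⁺ f allFalse-≼

NonConstant-up⇒allFalse : ∀ (f : BoolFun n) → NonConstant (up f) → f allFalse ≡ false
NonConstant-up⇒allFalse f (x , y , ne) =
  BoolP.¬-not λ f0 → ne (trans (up-allFalse f f0) (sym (up-allFalse f f0)))

Low-cong : ∀ {f g : BoolFun n} → (∀ x → f x ≡ g x) → ∀ {a} → Low f a → Low g a
Low-cong f≗g {a} (fa , minimal) =
  trans (sym (f≗g a)) fa , λ b b≼a b≢a → trans (sym (f≗g b)) (minimal b b≼a b≢a)

Low-up⁺ : ∀ (f : BoolFun n) {a} → Low f a → Low (up f) a
Low-up⁺ f (fa , minimal) = up≡true⁺ f ≼-refl fa , λ b b≼a b≢a → BoolP.¬-not λ ub →
  let z , z≼b , fz = up≡true⁻ f ub in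
  BoolP.not-¬ fz (minimal z (≼-trans z≼b b≼a) (≼-trans-≢ z≼b b≼a b≢a))

Low-up⁻ : ∀ (f : BoolFun n) {a} → Low (up f) a → Low f a
Low-up⁻ f {a} (ua , minimal) = fa , λ b b≼a b≢a → BoolP.¬-not λ fb →
  BoolP.not-¬ (up≡true⁺ f ≼-refl fb) (minimal b b≼a b≢a)
  where
  fa : f a ≡ true
  fa with z , z≼a , fz ← up≡true⁻ f ua | z ≟ᵢ a
  ... | yes refl = fz
  ... | no z≢a   = contradiction (minimal z z≼a z≢a) (BoolP.not-¬ (up≡true⁺ f ≼-refl fz))

Low-below : ∀ (g : BoolFun n) {s} → g s ≡ true → ∃ λ a → a ≼ s × Low g a
Low-below g = go (<-wellFounded _)
  where
  go : ∀ {s} → Acc _<_ (weight s) → g s ≡ true → ∃ λ a → a ≼ s × Low g a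
  go {s} (acc smaller) gs
    with ∃-input? (λ b → b ≼? s ×-dec ¬? (b ≟ᵢ s) ×-dec g b BoolP.≟ true)
  ... | yes (b , b≼s , b≢s , gb) =
    let a , a≼b , low = go (smaller (weight-strict b≼s b≢s)) gb in a , ≼-trans a≼b b≼s , low
  ... | no ∄b = s , ≼-refl , gs , λ b b≼s b≢s → BoolP.¬-not λ gb → ∄b (b , b≼s , b≢s , gb)

dependsOn? : ∀ (f : BoolFun n) i → Dec (DependsOn f i)
dependsOn? f i = ∃-input? λ x → ¬? (f x BoolP.≟ f (updateAt x i not))

dependencies : BoolFun n → Fin n → Bool
dependencies f i = does (dependsOn? f i)

cong-head : ∀ (f : BoolFun (suc n)) a b xs → (DependsOn f zero → a ≡ b) → f (a ∷ xs) ≡ f (b ∷ xs)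
cong-head f false false xs _ = refl
cong-head f true  true  xs _ = refl
cong-head f false true  xs h = decidable-stable (_ BoolP.≟ _) λ ne → contradiction (h (_ , ne)) λ ()
cong-head f true  false xs h = decidable-stable (_ BoolP.≟ _) λ ne → contradiction (h (_ , ne)) λ ()

≡-on-dependencies : ∀ (f : BoolFun n) {x y} → (∀ i → DependsOn f i → lookup x i ≡ lookup y i) → f x ≡ f y
≡-on-dependencies f {[]}    {[]}    _     = refl
≡-on-dependencies f {a ∷ x} {b ∷ y} agree = trans (cong-head f a b x (agree zero))
  (≡-on-dependencies (λ v → f (b ∷ v)) λ i (v , ne) → agree (suc i) (b ∷ v , ne))

DependsOn-cong : ∀ {f g : BoolFun n} → (∀ x → f x ≡ g x) → ∀ {i} → DependsOn f i → DependsOn g i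
DependsOn-cong f≗g (x , ne) = x , λ e → ne (trans (f≗g x) (trans e (sym (f≗g _))))

select : (Fin n → Bool) → Input n → Input n → Input n
select p x y = tabulate λ i → if p i then lookup x i else lookup y i

lookup-select : ∀ (p : Fin n → Bool) x y i → lookup (select p x y) i ≡ (if p i then lookup x i else lookup y i)
lookup-select p x y = VecP.lookup∘tabulate _

lookup-select-true : ∀ {p : Fin n → Bool} {i} x y → p i ≡ true → lookup (select p x y) i ≡ lookup x i
lookup-select-true {p = p} {i} x y pi = trans (lookup-select p x y i) (BoolP.if-cong pi)

lookup-select-false : ∀ {p : Fin n → Bool} {i} x y → p i ≡ false → lookup (select p x y) i ≡ lookup y i
lookup-select-false {p = p} {i} x y pi = trans (lookup-select p x y i) (BoolP.if-cong pi)

select-swap : ∀ (p : Fin n → Bool) x y → select (not ∘ p) x y ≡ select p y x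
select-swap p x y = VecP.tabulate-cong λ i → BoolP.if-not (p i)

select-≼ : ∀ (p : Fin n → Bool) {x y z} → x ≼ z → y ≼ z → select p x y ≼ z
select-≼ p {x} {y} x≼z y≼z = pointwise⁺ λ i →
  subst (Bool._≤ _) (sym (lookup-select p x y i)) (if-≤ (p i) (PW.lookup x≼z i) (PW.lookup y≼z i))
  where
  if-≤ : ∀ b {u v w} → u Bool.≤ w → v Bool.≤ w → (if b then u else v) Bool.≤ w
  if-≤ true  u≤w _ = u≤w
  if-≤ false _ v≤w = v≤w

Separates : (Fin n → Bool) → BoolFun n → BoolFun n → Set
Separates p g h = (∀ i → DependsOn g i → p i ≡ true) × (∀ i → DependsOn h i → p i ≡ false)

Independent⇒Separates : ∀ {g h : BoolFun n} → Independent g h → Separates (dependencies g) g h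
Independent⇒Separates {g = g} ind =
  (λ i dg → dec-true (dependsOn? g i) dg) , (λ i dh → dec-false (dependsOn? g i) λ dg → ind i (dg , dh))

Separates-swap : ∀ {p} {g h : BoolFun n} → Separates p g h → Separates (not ∘ p) h g
Separates-swap (g-in , h-out) = (λ i dh → cong not (h-out i dh)) , (λ i dg → cong not (g-in i dg))

select-left : ∀ {p} (g : BoolFun n) {x y} → (∀ i → DependsOn g i → p i ≡ true) → g (select p x y) ≡ g x
select-left g {x} {y} g-in = ≡-on-dependencies g λ i dg → lookup-select-true x y (g-in i dg)

select-right : ∀ {p} (h : BoolFun n) {x y} → (∀ i → DependsOn h i → p i ≡ false) → h (select p x y) ≡ h y
select-right h {x} {y} h-out = ≡-on-dependencies h λ i dh → lookup-select-false x y (h-out i dh)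

up-var : ∀ (i : Fin n) x → up (λ x → lookup x i) x ≡ lookup x i
up-var i x = ≡true-ext
  (λ u → let z , z≼x , zi = up≡true⁻ _ u in ≤-true (PW.lookup z≼x i) zi)
  (up≡true⁺ (λ x → lookup x i) ≼-refl)

up-∨ : ∀ (g h : BoolFun n) x → up (λ x → g x ∨ h x) x ≡ up g x ∨ up h x
up-∨ g h x = ≡true-ext
  (λ u → let z , z≼x , e = up≡true⁻ _ u in ∨≡true⁺ (Sum.map (up≡true⁺ g z≼x) (up≡true⁺ h z≼x) (∨≡true⁻ e)))
  (λ u → Sum.[ up-mono {f = g} (λ _ → ∨≡true⁺ ∘ inj₁) , up-mono {f = h} (λ _ → ∨≡true⁺ ∘ inj₂) ]
           (∨≡true⁻ {up g x} u))

up-∧ : ∀ {g h : BoolFun n} → Independent g h → ∀ x → up (λ x → g x ∧ h x) x ≡ up g x ∧ up h x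
up-∧ {g = g} {h} ind x = ≡true-ext
  (λ u → let z , z≼x , e = up≡true⁻ _ u ; gz , hz = ∧≡true⁻ e in
         ∧≡true⁺ (up≡true⁺ g z≼x gz) (up≡true⁺ h z≼x hz))
  (λ u → let ug , uh = ∧≡true⁻ u ; z₁ , z₁≼x , gz₁ = up≡true⁻ g ug ; z₂ , z₂≼x , hz₂ = up≡true⁻ h uh
             g-in , h-out = Independent⇒Separates ind in
         up≡true⁺ _ (select-≼ (dependencies g) {z₁} {z₂} z₁≼x z₂≼x)
           (∧≡true⁺ (trans (select-left g {z₁} {z₂} g-in) gz₁) (trans (select-right h {z₁} {z₂} h-out) hz₂)))

up-≡-on-dependencies : ∀ (g : BoolFun n) {x y} → (∀ i → DependsOn g i → lookup x i ≡ lookup y i) →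
                       up g x ≡ up g y
up-≡-on-dependencies g agree = ≡true-ext (transport agree) (transport (λ i d → sym (agree i d)))
  where
  transport : ∀ {x y} → (∀ i → DependsOn g i → lookup x i ≡ lookup y i) → up g x ≡ true → up g y ≡ true
  transport {x} {y} agree u with z , z≼x , gz ← up≡true⁻ g u =
    up≡true⁺ g (pointwise⁺ restricted≤y)
      (trans (select-left g {z} {allFalse} (λ i → dec-true (dependsOn? g i))) gz)
    where
    restricted≤y : ∀ i → lookup (select (dependencies g) z allFalse) i Bool.≤ lookup y i
    restricted≤y i = subst (Bool._≤ _) (sym (lookup-select (dependencies g) z allFalse i)) (bound (dependsOn? g i))
      where
      bound : (d? : Dec (DependsOn g i)) → (if does d? then lookup z i else lookup allFalse i) Bool.≤ lookup y i
      bound (yes d) = subst (_ Bool.≤_) (agree i d) (PW.lookup z≼x i)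
      bound (no _)  = PW.lookup (allFalse-≼ {x = y}) i

DependsOn-up : ∀ (g : BoolFun n) i → DependsOn (up g) i → DependsOn g i
DependsOn-up g i (x , ne) with dependsOn? g i
... | yes d  = d
... | no ¬d = contradiction (up-≡-on-dependencies g λ j dj →
    sym (VecP.lookup∘updateAt′ j i (λ { refl → ¬d dj }) x)) ne

Independent-up : ∀ {g h g′ h′ : BoolFun n} → Independent g h → (∀ x → g′ x ≡ up g x) → (∀ x → h′ x ≡ up h x) →
                 Independent g′ h′
Independent-up {g = g} {h} ind g′≗ h′≗ i (dg , dh) =
  ind i (DependsOn-up g i (DependsOn-cong g′≗ dg) , DependsOn-up h i (DependsOn-cong h′≗ dh))

-- From multilinear DeMorgan circuits to monotone ones

valueAtAllFalse : Gates BOp (Lit n) k → Node (Lit n) k → Bool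
valueAtAllFalse gs v = nodeFun litVal gs v allFalse

-- ¬xᵢ is 1 at allFalse, so the node it is sent to is never read.
toMonotoneNode : Node (Lit n) k → Node (Fin n) k
toMonotoneNode (input (inj₁ i)) = input i
toMonotoneNode (input (inj₂ i)) = input i
toMonotoneNode (gate j)         = gate j

-- The Booleans are the values of the two inputs at allFalse. An input with value 1 there has
-- constant closure 1: an AND gate then copies its other input, and a gate whose own value is 1
-- is arbitrary.
monotoneGate : BOp → Bool → Bool → Node (Fin n) k → Node (Fin n) k → BOp × Node (Fin n) k × Node (Fin n) k
monotoneGate o false false l r = o , l , r
monotoneGate o true  false l r = or , r , r
monotoneGate o _     true  l r = or , l , l

toMonotoneGates : Gates BOp (Lit n) k → Gates BOp (Fin n) k
toMonotoneGates []                 = []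
toMonotoneGates (gs ▷ (o , l , r)) = toMonotoneGates gs ▷
  monotoneGate o (valueAtAllFalse gs l) (valueAtAllFalse gs r) (toMonotoneNode l) (toMonotoneNode r)

toMonotone : DMCircuit n → MonCircuit n
toMonotone C = circuit (size C) (toMonotoneGates (gates C)) (toMonotoneNode (output C))

toMonotone-correct : (gs : Gates BOp (Lit n) k) → AllGates (MultilinearGate litVal) gs →
                     ∀ v → valueAtAllFalse gs v ≡ false →
                     ∀ x → nodeFun varVal (toMonotoneGates gs) (toMonotoneNode v) x ≡ up (nodeFun litVal gs v) x
toMonotone-correct gs ml (input (inj₁ i)) _ x = sym (up-var i x)
toMonotone-correct gs ml (input (inj₂ i)) e x =
  contradiction (trans (cong not (sym (VecP.lookup-replicate i false))) e) λ ()
toMonotone-correct (gs ▷ (o , l , r)) (ml , m) (gate zero) e x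
  with valueAtAllFalse gs l in el | valueAtAllFalse gs r in er | o
... | false | false | or  =
  trans (cong₂ _∨_ (toMonotone-correct gs ml l el x) (toMonotone-correct gs ml r er x)) (sym (up-∨ _ _ x))
... | false | false | and =
  trans (cong₂ _∧_ (toMonotone-correct gs ml l el x) (toMonotone-correct gs ml r er x)) (sym (up-∧ m x))
... | true  | false | and = begin
  hr′ x ∨ hr′ x            ≡⟨ BoolP.∨-idem _ ⟩
  hr′ x                    ≡⟨ toMonotone-correct gs ml r er x ⟩
  up hr x                  ≡⟨ cong (_∧ up hr x) (sym (up-allFalse hl el)) ⟩
  up hl x ∧ up hr x        ≡⟨ sym (up-∧ m x) ⟩
  up (λ x → hl x ∧ hr x) x ∎
  where
  open ≡-Reasoning
  hl hr hr′ : BoolFun _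
  hl = nodeFun litVal gs l
  hr = nodeFun litVal gs r
  hr′ = nodeFun varVal (toMonotoneGates gs) (toMonotoneNode r)
... | false | true  | and = begin
  hl′ x ∨ hl′ x            ≡⟨ BoolP.∨-idem _ ⟩
  hl′ x                    ≡⟨ toMonotone-correct gs ml l el x ⟩
  up hl x                  ≡⟨ sym (BoolP.∧-identityʳ _) ⟩
  up hl x ∧ true           ≡⟨ cong (up hl x ∧_) (sym (up-allFalse hr er)) ⟩
  up hl x ∧ up hr x        ≡⟨ sym (up-∧ m x) ⟩
  up (λ x → hl x ∧ hr x) x ∎
  where
  open ≡-Reasoning
  hl hr hl′ : BoolFun _
  hl = nodeFun litVal gs l
  hr = nodeFun litVal gs r
  hl′ = nodeFun varVal (toMonotoneGates gs) (toMonotoneNode l)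
toMonotone-correct (gs ▷ _) (ml , _) (gate (suc j)) e x = toMonotone-correct gs ml (gate j) e x

toMonotone-multilinear : (gs : Gates BOp (Lit n) k) → AllGates (MultilinearGate litVal) gs →
                         AllGates (MultilinearGate varVal) (toMonotoneGates gs)
toMonotone-multilinear []                 _        = tt
toMonotone-multilinear (gs ▷ (o , l , r)) (ml , m)
  with valueAtAllFalse gs l in el | valueAtAllFalse gs r in er | o
... | false | false | and = toMonotone-multilinear gs ml ,
  Independent-up m (toMonotone-correct gs ml l el) (toMonotone-correct gs ml r er)
... | false | false | or  = toMonotone-multilinear gs ml , tt
... | true  | false | _   = toMonotone-multilinear gs ml , tt
... | false | true  | _   = toMonotone-multilinear gs ml , tt
... | true  | true  | _   = toMonotone-multilinear gs ml , tt

toMonotone-computes : ∀ (C : DMCircuit n) {f} → Computes litVal C f → Multilinear litVal C →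
                      f allFalse ≡ false → Computes varVal (toMonotone C) (up f)
toMonotone-computes C computes ml f0 x =
  trans (toMonotone-correct (gates C) ml (output C) (trans (computes allFalse) f0) x) (up-cong computes x)

-- Minimal points of multilinear monotone circuits

unitInput : Fin n → Input n
unitInput i = allFalse [ i ]≔ true

embed-unitInput : ∀ (i : Fin n) → embed (unitInput i) ≡ unitVec i
embed-unitInput i = trans (VecP.map-[]≔ bit allFalse i) (cong (_[ i ]≔ 1) (VecP.map-replicate bit false _))

unitInput-≼ : ∀ {i} {a : Input n} → lookup a i ≡ true → unitInput i ≼ a
unitInput-≼ {i = i} {a} ai = pointwise⁺ λ j → bound j (j Fin.≟ i)
  where
  bound : ∀ j → Dec (j ≡ i) → lookup (unitInput i) j Bool.≤ lookup a j
  bound j (yes refl) = subst₂ Bool._≤_ (sym (VecP.lookup∘update i allFalse true)) (sym ai) Bool.b≤b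
  bound j (no j≢i)   =
    subst (Bool._≤ _) (sym (trans (VecP.lookup∘update′ j≢i allFalse true) (VecP.lookup-replicate j false)))
      (BoolP.≤-minimum _)

Low-var : ∀ (i : Fin n) {a} → Low (λ x → lookup x i) a → embed a ≡ unitVec i
Low-var i {a} (ai , minimal) with unitInput i ≟ᵢ a
... | yes refl = embed-unitInput i
... | no ≢a    = contradiction (minimal (unitInput i) (unitInput-≼ ai) ≢a)
                   (BoolP.not-¬ (VecP.lookup∘update i allFalse true))

Low-∨ : ∀ {g h : BoolFun n} {a} → Low (λ x → g x ∨ h x) a → Low g a ⊎ Low h a
Low-∨ {g = g} {h} (e , minimal) = Sum.map
  (_, λ b b≼a b≢a → BoolP.∨-conicalˡ (g b) (h b) (minimal b b≼a b≢a))
  (_, λ b b≼a b≢a → BoolP.∨-conicalʳ (g b) (h b) (minimal b b≼a b≢a))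
  (∨≡true⁻ e)

-- A point b strictly below a₁ with g b = 1 would give the point select p b a strictly below a,
-- where g ∧ h still holds.
Low-∧ˡ : ∀ {p} {g h : BoolFun n} {a} → Separates p g h → Low (λ x → g x ∧ h x) a → Low g (select p a allFalse)
Low-∧ˡ {p = p} {g} {h} {a} (g-in , h-out) (e , minimal) =
  trans (select-left g {a} {allFalse} g-in) (proj₁ (∧≡true⁻ e)) , λ b b≼a₁ b≢a₁ → BoolP.¬-not λ gb →
    BoolP.not-¬ (∧≡true⁺ (trans (select-left g {b} {a} g-in) gb) (trans (select-right h {b} {a} h-out) (proj₂ (∧≡true⁻ e))))
      (minimal (select p b a) (select-≼ p (≼-trans b≼a₁ a₁≼a) ≼-refl) (b≢a₁ ∘ collapse b b≼a₁))
  where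
  a₁ : Input _
  a₁ = select p a allFalse
  a₁≼a : a₁ ≼ a
  a₁≼a = select-≼ p ≼-refl allFalse-≼
  collapse : ∀ b → b ≼ a₁ → select p b a ≡ a → b ≡ a₁
  collapse b b≼a₁ eq = ≡-lookup λ i → coordinate i (p i) refl
    where
    coordinate : ∀ i c → p i ≡ c → lookup b i ≡ lookup a₁ i
    coordinate i true  pi = begin
      lookup b i               ≡⟨ sym (lookup-select-true b a pi) ⟩
      lookup (select p b a) i  ≡⟨ cong (λ v → lookup v i) eq ⟩
      lookup a i               ≡⟨ sym (lookup-select-true a allFalse pi) ⟩
      lookup a₁ i              ∎
      where open ≡-Reasoning
    coordinate i false pi = trans (≤-false (PW.lookup b≼a₁ i) a₁i) (sym a₁i)
      where
      a₁i : lookup a₁ i ≡ false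
      a₁i = trans (lookup-select-false a allFalse pi) (VecP.lookup-replicate i false)

Low-∧ : ∀ {p} {g h : BoolFun n} {a} → Separates p g h → Low (λ x → g x ∧ h x) a →
        Low g (select p a allFalse) × Low h (select p allFalse a)
Low-∧ {p = p} {g} {h} {a} sep low = Low-∧ˡ sep low ,
  subst (Low h) (select-swap p a allFalse)
    (Low-∧ˡ (Separates-swap sep) (Low-cong (λ x → BoolP.∧-comm (g x) (h x)) low))

embed-select : ∀ (p : Fin n → Bool) a → embed a ≡ embed (select p a allFalse) +ᵥ embed (select p allFalse a)
embed-select p a = ≡-lookup λ i → begin
  lookup (embed a) i
    ≡⟨ VecP.lookup-map i bit a ⟩
  bit (lookup a i)
    ≡⟨ split (p i) refl ⟩
  bit (lookup a₁ i) + bit (lookup a₂ i)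
    ≡⟨ sym (cong₂ _+_ (VecP.lookup-map i bit a₁) (VecP.lookup-map i bit a₂)) ⟩
  lookup (embed a₁) i + lookup (embed a₂) i
    ≡⟨ sym (VecP.lookup-zipWith _+_ i (embed a₁) (embed a₂)) ⟩
  lookup (embed a₁ +ᵥ embed a₂) i ∎
  where
  open ≡-Reasoning
  a₁ a₂ : Input _
  a₁ = select p a allFalse
  a₂ = select p allFalse a
  split : ∀ {i} c → p i ≡ c → bit (lookup a i) ≡ bit (lookup a₁ i) + bit (lookup a₂ i)
  split {i} true  pi = trans (sym (ℕP.+-identityʳ _)) (sym (cong₂ (λ u v → bit u + bit v)
    (lookup-select-true a allFalse pi) (trans (lookup-select-true allFalse a pi) (VecP.lookup-replicate i false))))
  split {i} false pi = sym (cong₂ (λ u v → bit u + bit v)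
    (trans (lookup-select-false a allFalse pi) (VecP.lookup-replicate i false)) (lookup-select-false allFalse a pi))

BsetAt : Gates BOp (Fin n) k → Node (Fin n) k → List (Exp n)
BsetAt = Eval.nodeVal ⟦_⟧ᴮ (λ i → [ unitVec i ])

Low⊆BsetAt : (gs : Gates BOp (Fin n) k) → AllGates (MultilinearGate varVal) gs →
             ∀ v {a} → Low (nodeFun varVal gs v) a → embed a ∈ BsetAt gs v
Low⊆BsetAt gs ml (input i) low = here (Low-var i low)
Low⊆BsetAt (gs ▷ (or , l , r)) (ml , _) (gate zero) low =
  Sum.[ ∈-++⁺ˡ ∘ Low⊆BsetAt gs ml l , ∈-++⁺ʳ _ ∘ Low⊆BsetAt gs ml r ] (Low-∨ low)
Low⊆BsetAt (gs ▷ (and , l , r)) (ml , ind) (gate zero) {a} low =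
  let low₁ , low₂ = Low-∧ (Independent⇒Separates ind) low in
  subst (_∈ _) (sym (embed-select _ a))
    (∈-cartesianProductWith⁺ _+ᵥ_ (Low⊆BsetAt gs ml l low₁) (Low⊆BsetAt gs ml r low₂))
Low⊆BsetAt (gs ▷ _) (ml , _) (gate (suc j)) low = Low⊆BsetAt gs ml (gate j) low

multilinear-read₁ : ∀ (C : MonCircuit n) {g} → Computes varVal C g → Multilinear varVal C →
                    ∀ a → Low g a → embed a ∈ Bset C
multilinear-read₁ C computes ml a low = Low⊆BsetAt (gates C) ml (output C) (Low-cong (sym ∘ computes) low)

-- Supports and the minimum-degree part of a B-set

isNonZero : ℕ → Bool
isNonZero zero    = false
isNonZero (suc _) = true

support : Exp n → Input n
support = Vec.map isNonZero

support-+ˡ : (x y : Exp n) → support x ≼ support (x +ᵥ y)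
support-+ˡ []          []      = []
support-+ˡ (zero ∷ x)  (_ ∷ y) = BoolP.≤-minimum _ ∷ support-+ˡ x y
support-+ˡ (suc _ ∷ x) (_ ∷ y) = Bool.b≤b ∷ support-+ˡ x y

support-+ʳ : (x y : Exp n) → support y ≼ support (x +ᵥ y)
support-+ʳ x y = subst (λ z → support y ≼ support z) (VecP.zipWith-comm ℕP.+-comm y x) (support-+ˡ y x)

weight-support : (b : Exp n) → weight (support b) ≤ degree b
weight-support []          = z≤n
weight-support (zero ∷ b)  = weight-support b
weight-support (suc _ ∷ b) = s≤s (ℕP.≤-trans (weight-support b) (ℕP.m≤n+m _ _))

embed-support : (b : Exp n) → weight (support b) ≡ degree b → embed (support b) ≡ b
embed-support []                _ = refl
embed-support (zero ∷ b)        e = cong (0 ∷_) (embed-support b e)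
embed-support (suc zero ∷ b)    e = cong (1 ∷_) (embed-support b (ℕP.suc-injective e))
embed-support (suc (suc k) ∷ b) e =
  contradiction (ℕP.suc-injective e) (ℕP.<⇒≢ (s≤s (ℕP.≤-trans (weight-support b) (ℕP.m≤n+m _ k))))

BsetAt-sound : (gs : Gates BOp (Fin n) k) → ∀ v {b x} → b ∈ BsetAt gs v → support b ≼ x →
               nodeFun varVal gs v x ≡ true
BsetAt-sound gs (input i) (here refl) le = ≤-true (PW.lookup le i)
  (trans (VecP.lookup-map i isNonZero (unitVec i)) (cong isNonZero (VecP.lookup∘update i (replicate _ 0) 1)))
BsetAt-sound (gs ▷ (or , l , r)) (gate zero) b∈ le = ∨≡true⁺ (Sum.map
  (λ b∈l → BsetAt-sound gs l b∈l le) (λ b∈r → BsetAt-sound gs r b∈r le) (∈-++⁻ (BsetAt gs l) b∈))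
BsetAt-sound (gs ▷ (and , l , r)) (gate zero) b∈ le
  with y , z , y∈ , z∈ , refl ← ∈-cartesianProductWith⁻ _+ᵥ_ (BsetAt gs l) (BsetAt gs r) b∈ =
  ∧≡true⁺ (BsetAt-sound gs l y∈ (≼-trans (support-+ˡ y z) le)) (BsetAt-sound gs r z∈ (≼-trans (support-+ʳ y z) le))
BsetAt-sound (gs ▷ _) (gate (suc j)) b∈ le = BsetAt-sound gs (gate j) b∈ le

module _ (f : BoolFun n) (B : Exp n → Set)
         (B-sound : ∀ {b} → B b → up f (support b) ≡ true)
         (B-complete : ∀ {a} → Low (up f) a → B (embed a)) where

  private
    Low-below-support : ∀ {b} → B b → ∃ λ a → Low (up f) a × a ≼ support b
    Low-below-support Bb = let a , a≼ , low = Low-below (up f) (B-sound Bb) in a , low , a≼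

  -- For b of least degree in B and a ∈ Low below its support, degree b ≤ |a| ≤ |support b| ≤ degree b.
  Env-Low⁺ : ∀ {b} → Env B b → Env (LowExp f) b
  Env-Low⁺ {b} (Bb , minimal) = (support b , Low-up⁻ f low-support , sym embed≡b) , minimal-Low
    where
    a : Input n
    a = proj₁ (Low-below-support Bb)
    low : Low (up f) a
    low = proj₁ (proj₂ (Low-below-support Bb))
    a≼ : a ≼ support b
    a≼ = proj₂ (proj₂ (Low-below-support Bb))
    b≤a : degree b ≤ weight a
    b≤a = minimal (embed a) (B-complete low)
    a≤s : weight a ≤ weight (support b)
    a≤s = weight-mono a≼
    embed≡b : embed (support b) ≡ b
    embed≡b = embed-support b (ℕP.≤-antisym (weight-support b) (ℕP.≤-trans b≤a a≤s))
    low-support : Low (up f) (support b)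
    low-support = subst (Low (up f)) (≼-weight-≡ a≼ (ℕP.≤-antisym a≤s
      (ℕP.≤-trans (ℕP.≤-reflexive (cong degree embed≡b)) b≤a))) low
    minimal-Low : ∀ c → LowExp f c → degree b ≤ degree c
    minimal-Low _ (a′ , low′ , refl) = minimal _ (B-complete (Low-up⁺ f low′))

  Env-Low⁻ : ∀ {b} → Env (LowExp f) b → Env B b
  Env-Low⁻ ((a , low , refl) , minimal) = B-complete (Low-up⁺ f low) , λ c Bc →
    let a′ , low′ , a′≼ = Low-below-support Bc in
    ℕP.≤-trans (minimal (embed a′) (a′ , Low-up⁻ f low′ , refl))
               (ℕP.≤-trans (weight-mono a′≼) (weight-support c))

-- Pruning to the minimum degree

degree-replicate-0 : ∀ n → degree (replicate n 0) ≡ 0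
degree-replicate-0 zero    = refl
degree-replicate-0 (suc n) = degree-replicate-0 n

degree-unitVec : (i : Fin n) → degree (unitVec i) ≡ 1
degree-unitVec {suc n} zero    = cong suc (degree-replicate-0 n)
degree-unitVec {suc n} (suc i) = degree-unitVec i

degree-+ᵥ : (x y : Exp n) → degree (x +ᵥ y) ≡ degree x + degree y
degree-+ᵥ []      []      = refl
degree-+ᵥ (a ∷ x) (b ∷ y) = trans (cong (a + b +_) (degree-+ᵥ x y)) (interchange a b (degree x) (degree y))

+-≡⇒≡ : ∀ {a b c d} → a ≤ c → b ≤ d → c + d ≡ a + b → c ≡ a × d ≡ b
+-≡⇒≡ {a} {b} {c} {d} a≤c b≤d e = c≡a , ℕP.+-cancelˡ-≡ a d b (subst (λ x → x + d ≡ a + b) c≡a e)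
  where
  c≡a : c ≡ a
  c≡a = ℕP.≤-antisym (ℕP.+-cancelʳ-≤ d c a (ℕP.≤-trans (ℕP.≤-reflexive e) (ℕP.+-monoʳ-≤ a b≤d))) a≤c

⟦_⟧ᵈ : BOp → ℕ → ℕ → ℕ
⟦ or  ⟧ᵈ = _⊓_
⟦ and ⟧ᵈ = _+_

minDegreeAt : Gates BOp (Fin n) k → Node (Fin n) k → ℕ
minDegreeAt = Eval.nodeVal ⟦_⟧ᵈ (λ _ → 1)

Lowest : Gates BOp (Fin n) k → Node (Fin n) k → Exp n → Set
Lowest gs v b = b ∈ BsetAt gs v × degree b ≡ minDegreeAt gs v

minDegree-≤ : (gs : Gates BOp (Fin n) k) → ∀ v {b} → b ∈ BsetAt gs v → minDegreeAt gs v ≤ degree b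
minDegree-≤ gs (input i) (here refl) = ℕP.≤-reflexive (sym (degree-unitVec i))
minDegree-≤ (gs ▷ (or , l , r)) (gate zero) b∈ = Sum.[
  (λ b∈l → ℕP.≤-trans (ℕP.m⊓n≤m _ _) (minDegree-≤ gs l b∈l)) ,
  (λ b∈r → ℕP.≤-trans (ℕP.m⊓n≤n _ _) (minDegree-≤ gs r b∈r)) ] (∈-++⁻ (BsetAt gs l) b∈)
minDegree-≤ (gs ▷ (and , l , r)) (gate zero) b∈
  with y , z , y∈ , z∈ , refl ← ∈-cartesianProductWith⁻ _+ᵥ_ (BsetAt gs l) (BsetAt gs r) b∈ =
  ℕP.≤-trans (ℕP.+-mono-≤ (minDegree-≤ gs l y∈) (minDegree-≤ gs r z∈)) (ℕP.≤-reflexive (sym (degree-+ᵥ y z)))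
minDegree-≤ (gs ▷ _) (gate (suc j)) b∈ = minDegree-≤ gs (gate j) b∈

minDegree-attained : (gs : Gates BOp (Fin n) k) → ∀ v → ∃ (Lowest gs v)
minDegree-attained gs (input i) = unitVec i , here refl , degree-unitVec i
minDegree-attained (gs ▷ (or , l , r)) (gate zero) with ℕP.⊓-sel (minDegreeAt gs l) (minDegreeAt gs r)
... | inj₁ ⊓≡l = let b , b∈ , e = minDegree-attained gs l in b , ∈-++⁺ˡ b∈ , trans e (sym ⊓≡l)
... | inj₂ ⊓≡r = let b , b∈ , e = minDegree-attained gs r in b , ∈-++⁺ʳ _ b∈ , trans e (sym ⊓≡r)
minDegree-attained (gs ▷ (and , l , r)) (gate zero) =
  let y , y∈ , ey = minDegree-attained gs l ; z , z∈ , ez = minDegree-attained gs r in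
  y +ᵥ z , ∈-cartesianProductWith⁺ _+ᵥ_ y∈ z∈ , trans (degree-+ᵥ y z) (cong₂ _+_ ey ez)
minDegree-attained (gs ▷ _) (gate (suc j)) = minDegree-attained gs (gate j)

Lowest⇔Env : (gs : Gates BOp (Fin n) k) → ∀ v {b} → Lowest gs v b ⇔ Env (_∈ BsetAt gs v) b
Lowest⇔Env gs v = mk⇔
  (λ (b∈ , e) → b∈ , λ c c∈ → ℕP.≤-trans (ℕP.≤-reflexive e) (minDegree-≤ gs v c∈))
  (λ (b∈ , minimal) → let c , c∈ , e = minDegree-attained gs v in
    b∈ , ℕP.≤-antisym (ℕP.≤-trans (minimal c c∈) (ℕP.≤-reflexive e)) (minDegree-≤ gs v b∈))

-- Keeping an input twice doubles coefficients, which Produces allows.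
pruneGate : BOp → ℕ → ℕ → Node (Fin n) k → Node (Fin n) k → AOp × Node (Fin n) k × Node (Fin n) k
pruneGate or  dl dr l r = plus , (if does (dl ℕ.≤? dr) then l else r) , (if does (dr ℕ.≤? dl) then r else l)
pruneGate and _  _  l r = times , l , r

pruneGates : Gates BOp (Fin n) k → Gates AOp (Fin n) k
pruneGates []                 = []
pruneGates (gs ▷ (o , l , r)) = pruneGates gs ▷ pruneGate o (minDegreeAt gs l) (minDegreeAt gs r) l r

prune : MonCircuit n → ArithCircuit n
prune C = circuit (size C) (pruneGates (gates C)) (output C)

expansionAt : Gates AOp (Fin n) k → Node (Fin n) k → List (Exp n)
expansionAt = Eval.nodeVal ⟦_⟧ᴬ (λ i → [ unitVec i ])

module _ (gs : Gates BOp (Fin n) k) (l r : Node (Fin n) k) {b : Exp n} where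

  private
    dl dr : ℕ
    dl = minDegreeAt gs l
    dr = minDegreeAt gs r
    gs∨ : Gates BOp (Fin n) (suc k)
    gs∨ = gs ▷ (or , l , r)

  Lowest-∨ˡ : dl ≤ dr → Lowest gs l b → Lowest gs∨ (gate zero) b
  Lowest-∨ˡ le (b∈ , e) = ∈-++⁺ˡ b∈ , trans e (sym (ℕP.m≤n⇒m⊓n≡m le))

  Lowest-∨ʳ : dr ≤ dl → Lowest gs r b → Lowest gs∨ (gate zero) b
  Lowest-∨ʳ le (b∈ , e) = ∈-++⁺ʳ _ b∈ , trans e (sym (ℕP.m≥n⇒m⊓n≡n le))

  Lowest-∨⁻ : Lowest gs∨ (gate zero) b → (dl ≤ dr × Lowest gs l b) ⊎ (dr ≤ dl × Lowest gs r b)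
  Lowest-∨⁻ (b∈ , e) = Sum.map
    (λ b∈l → let dl≤ = minDegree-≤ gs l b∈l ; ≤dl = ℕP.≤-trans (ℕP.≤-reflexive e) (ℕP.m⊓n≤m dl dr) in
      ℕP.≤-trans dl≤ (ℕP.≤-trans (ℕP.≤-reflexive e) (ℕP.m⊓n≤n dl dr)) , b∈l , ℕP.≤-antisym ≤dl dl≤)
    (λ b∈r → let dr≤ = minDegree-≤ gs r b∈r ; ≤dr = ℕP.≤-trans (ℕP.≤-reflexive e) (ℕP.m⊓n≤n dl dr) in
      ℕP.≤-trans dr≤ (ℕP.≤-trans (ℕP.≤-reflexive e) (ℕP.m⊓n≤m dl dr)) , b∈r , ℕP.≤-antisym ≤dr dr≤)
    (∈-++⁻ (BsetAt gs l) b∈)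

pruned⇒Lowest : (gs : Gates BOp (Fin n) k) → ∀ v {b} → b ∈ expansionAt (pruneGates gs) v → Lowest gs v b
pruned⇒Lowest gs (input i) (here refl) = here refl , degree-unitVec i
pruned⇒Lowest (gs ▷ (or , l , r)) (gate zero) {b} b∈ =
  Sum.[ keptˡ (minDegreeAt gs l ℕ.≤? minDegreeAt gs r) , keptʳ (minDegreeAt gs r ℕ.≤? minDegreeAt gs l) ]
    (∈-++⁻ _ b∈)
  where
  keptˡ : (d? : Dec (minDegreeAt gs l ≤ minDegreeAt gs r)) →
          b ∈ expansionAt (pruneGates gs) (if does d? then l else r) → Lowest (gs ▷ (or , l , r)) (gate zero) b
  keptˡ (yes le) b∈ = Lowest-∨ˡ gs l r le (pruned⇒Lowest gs l b∈)
  keptˡ (no ¬le) b∈ = Lowest-∨ʳ gs l r (ℕP.≰⇒≥ ¬le) (pruned⇒Lowest gs r b∈)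
  keptʳ : (d? : Dec (minDegreeAt gs r ≤ minDegreeAt gs l)) →
          b ∈ expansionAt (pruneGates gs) (if does d? then r else l) → Lowest (gs ▷ (or , l , r)) (gate zero) b
  keptʳ (yes le) b∈ = Lowest-∨ʳ gs l r le (pruned⇒Lowest gs r b∈)
  keptʳ (no ¬le) b∈ = Lowest-∨ˡ gs l r (ℕP.≰⇒≥ ¬le) (pruned⇒Lowest gs l b∈)
pruned⇒Lowest (gs ▷ (and , l , r)) (gate zero) b∈
  with y , z , y∈ , z∈ , refl ← ∈-cartesianProductWith⁻ _+ᵥ_ (expansionAt (pruneGates gs) l) _ b∈ =
  let y∈′ , ey = pruned⇒Lowest gs l y∈ ; z∈′ , ez = pruned⇒Lowest gs r z∈ in
  ∈-cartesianProductWith⁺ _+ᵥ_ y∈′ z∈′ , trans (degree-+ᵥ y z) (cong₂ _+_ ey ez)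
pruned⇒Lowest (gs ▷ _) (gate (suc j)) b∈ = pruned⇒Lowest gs (gate j) b∈

Lowest⇒pruned : (gs : Gates BOp (Fin n) k) → ∀ v {b} → Lowest gs v b → b ∈ expansionAt (pruneGates gs) v
Lowest⇒pruned gs (input i) (b∈ , _) = b∈
Lowest⇒pruned (gs ▷ (or , l , r)) (gate zero) {b} lowest with Lowest-∨⁻ gs l r lowest
... | inj₁ (le , lowestˡ) = ∈-++⁺ˡ (subst (λ c → b ∈ expansionAt (pruneGates gs) c)
  (sym (BoolP.if-cong (dec-true (_ ℕ.≤? _) le))) (Lowest⇒pruned gs l lowestˡ))
... | inj₂ (le , lowestʳ) = ∈-++⁺ʳ _ (subst (λ c → b ∈ expansionAt (pruneGates gs) c)
  (sym (BoolP.if-cong (dec-true (_ ℕ.≤? _) le))) (Lowest⇒pruned gs r lowestʳ))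
Lowest⇒pruned (gs ▷ (and , l , r)) (gate zero) (b∈ , e)
  with y , z , y∈ , z∈ , refl ← ∈-cartesianProductWith⁻ _+ᵥ_ (BsetAt gs l) (BsetAt gs r) b∈ =
  let ey , ez = +-≡⇒≡ (minDegree-≤ gs l y∈) (minDegree-≤ gs r z∈) (trans (sym (degree-+ᵥ y z)) e) in
  ∈-cartesianProductWith⁺ _+ᵥ_ (Lowest⇒pruned gs l (y∈ , ey)) (Lowest⇒pruned gs r (z∈ , ez))
Lowest⇒pruned (gs ▷ _) (gate (suc j)) lowest = Lowest⇒pruned gs (gate j) lowest

prune-produces : ∀ (f : BoolFun n) (C : MonCircuit n) → Computes varVal C (up f) →
                 (∀ a → Low (up f) a → embed a ∈ Bset C) → Produces (prune C) (Env (LowExp f))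
prune-produces f C computes read₁ b = mk⇔
  (Env-Low⁺ f B sound (read₁ _) ∘ Lowest⇔Env gs out .to ∘ pruned⇒Lowest gs out)
  (Lowest⇒pruned gs out ∘ Lowest⇔Env gs out .from ∘ Env-Low⁻ f B sound (read₁ _))
  where
  gs : Gates BOp (Fin _) (size C)
  gs = gates C
  out : Node (Fin _) (size C)
  out = output C
  B : Exp _ → Set
  B = _∈ Bset C
  sound : ∀ {b} → B b → up f (support b) ≡ true
  sound b∈ = trans (sym (computes _)) (BsetAt-sound gs out b∈ ≼-refl)

IsMinSize-≤ : ∀ {Op I Op′ I′} {P : Circuit Op I → Set} {Q : Circuit Op′ I′ → Set} {m m′} →
              IsMinSize P m → IsMinSize Q m′ → (∀ C → Q C → ∃ λ C′ → P C′ × size C′ ≡ size C) → m ≤ m′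
IsMinSize-≤ (_ , minimal) ((C , QC , refl) , _) simulate =
  let C′ , PC′ , e = simulate C QC in ℕP.≤-trans (minimal C′ PC′) (ℕP.≤-reflexive e)

theorem3 : ∀ n (f : BoolFun n) → NonConstant (up f) →
    ∀ a r m l →
    IsArith (Env (LowExp f)) a → IsRead1 (up f) r → IsMLin (up f) m → IsLin f l →
    a ≤ r × r ≤ m × m ≤ l
theorem3 n f nonConstant a r m l arith read₁ mLin lin =
  IsMinSize-≤ arith read₁ (λ C (computes , lows) → prune C , prune-produces f C computes lows , refl) ,
  IsMinSize-≤ read₁ mLin (λ C (computes , ml) → C , (computes , multilinear-read₁ C computes ml) , refl) ,
  IsMinSize-≤ mLin lin (λ C (computes , ml) → toMonotone C ,
    (toMonotone-computes C computes ml (NonConstant-up⇒allFalse f nonConstant) ,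
     toMonotone-multilinear (gates C) ml) , refl)
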